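{- Let $(\mathcal{R},\leq,r)$ be a \textbf{wA2}-space. If $(\mathcal{R},\leq,r)$ does not satisfy Axiom \textbf{A4}, then there exists a set $\mathcal{X}\subseteq\mathcal{R}$ such that both $\mathcal{X}$ and $\mathcal{R}\setminus\mathcal{X}$ are Kastanas Ramsey, but $\mathcal{X}$ is not Ramsey.
   Context: $\mathcal{R}$ nonempty, $\le$ quasi-order on $\mathcal{R}$, $r:\mathcal{R}\times\omega\to\mathcal{AR}$, $r_n(A):=r(A,n)$, $\mathcal{AR}_n$ the image of $r_n$. A1: (1) $r_0(A)=\emptyset$; (2) $A\ne B\Rightarrow r_n(A)\ne r_n(B)$ for some $n$; (3) $r_n(A)=r_m(B)\Rightarrow n=m$ and $r_k(A)=r_k(B)$ for $k<n$. $\mathrm{lh}(a)$: the $n$ with $a\in\mathcal{AR}_n$; $a\sqsubseteq b$ iff $a=r_m(A)$, $b=r_n(A)$ for some $A$, $m\le n$. wA2: a quasi-order $\leq_{\mathrm{fin}}$ on $\mathcal{AR}$ with (w1) $\{a:a\leq_{\mathrm{fin}}b\}$ countable; (2) $A\le B$ iff $\forall n\exists m\ r_n(A)\leq_{\mathrm{fin}}r_m(B)$; (3) $a\sqsubseteq b\leq_{\mathrm{fin}}c\Rightarrow\exists d\sqsubseteq c\ a\leq_{\mathrm{fin}}d$. $[a,A]=\{B\le A:\exists n\ r_n(B)=a\}$; $[n,A]=[r_n(A),A]$; $\mathrm{depth}_B(a)=\min\{n:a\leq_{\mathrm{fin}}r_n(B)\}$ or $\infty$; $\mathcal{AR}{\upharpoonright}A=\{a:\exists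 n\ a\leq_{\mathrm{fin}}r_n(A)\}$; $r_n[a,A]=\{b\in\mathcal{AR}{\upharpoonright}A:a\sqsubseteq b,\mathrm{lh}(b)=n\}$. A3: (1) $\mathrm{depth}_B(a)<\infty\Rightarrow[a,A]\ne\emptyset$ for all $A\in[\mathrm{depth}_B(a),B]$; (2) $A\le B$, $[a,A]\ne\emptyset\Rightarrow\exists A'\in[\mathrm{depth}_B(a),B]$ with $\emptyset\ne[a,A']\subseteq[a,A]$. A4: if $\mathrm{depth}_B(a)<\infty$ and $\mathcal{O}\subseteq\mathcal{AR}_{\mathrm{lh}(a)+1}$ there is $A\in[\mathrm{depth}_B(a),B]$ with $r_{\mathrm{lh}(a)+1}[a,A]\subseteq\mathcal{O}$ or $\subseteq\mathcal{O}^c$. A \textbf{wA2}-space: A1, wA2, A3 hold and $\mathcal{R}$ (identified with $\{(r_n(A))_n\}$) is closed in $\mathcal{AR}^{\mathbb N}$. Ramsey: for all $A$ and $a\in\mathcal{AR}{\upharpoonright}A$ there is $B\in[a,A]$ with $[a,B]\subseteq\mathcal{X}$ or $[a,B]\subseteq\mathcal{X}^c$. Kastanas game $K[a,A]$: with $a_0=a$, $B_{ -1}=A$, in round $n\ge0$ I plays $A_n\in[a_n,B_{n-1}]$, then II plays $a_{n+1}\in r_{\mathrm{lh}(a_n)+1}[a_n,A_n]$ and $B_n\in[a_{n+1},A_n]$; outcome: the $B$ with $r_{\mathrm{lh}(a)+n}(B)=a_n$ for all $n$. $\mathcal{X}$ is Kastanas Ramsey if for all $A$ and $a\in\mathcal{AR}{\upharpoonright}A$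 there is $B\in[a,A]$ such that I has a strategy in $K[a,B]$ ensuring the outcome lies in $\mathcal{X}^c$, or II has a strategy in $K[a,B]$ ensuring the outcome lies in $\mathcal{X}$. -}

module Defs where

open import Data.Nat using (ℕ; zero; suc; _+_; _≤_; _<_)
open import Data.Fin using (Fin; toℕ)
open import Data.Vec using (Vec; tabulate)
open import Data.Product using (Σ; ∃; ∃-syntax; _×_; _,_; proj₁; proj₂)
open import Data.Sum using (_⊎_)
open import Relation.Nullary using (¬_)
open import Relation.Binary.PropositionalEquality using (_≡_; _≢_)

record Structure : Set₁ where
  field
    R     : Set
    AR    : Set
    _≼_   : R → R → Set
    r     : R → ℕ → AR
    _≤fin_ : AR → AR → Set
    ∅     : AR

module Notions (S : Structure) where
  open Structure S

  Lh : AR → ℕ → Set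
  Lh a n = ∃[ A ] (r A n ≡ a)

  _⊑_ : AR → AR → Set
  a ⊑ b = ∃[ A ] ∃[ m ] ∃[ n ] (m ≤ n × r A m ≡ a × r A n ≡ b)

  [_,_] : AR → R → R → Set
  [ a , A ] B = B ≼ A × ∃[ n ] (r B n ≡ a)

  [_,_]ₙ : ℕ → R → R → Set
  [ n , A ]ₙ = [ r A n , A ]

  Depth : R → AR → ℕ → Set
  Depth B a n = (a ≤fin r B n) × (∀ m → a ≤fin r B m → n ≤ m)

  AR↾ : R → AR → Set
  AR↾ A a = ∃[ n ] (a ≤fin r A n)

  r[_,_]ₙ : AR → R → ℕ → AR → Set
  r[ a , A ]ₙ n b = AR↾ A b × a ⊑ b × Lh b n

  Next : AR → R → AR → Set
  Next a A b = ∃[ l ] (Lh a l × r[ a , A ]ₙ (suc l) b)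

  record A1 : Set where
    field
      A1-1 : ∀ A → r A 0 ≡ ∅
      A1-2 : ∀ A B → A ≢ B → ∃[ n ] (r A n ≢ r B n)
      A1-3 : ∀ A B n m → r A n ≡ r B m →
               (n ≡ m) × (∀ k → k < n → r A k ≡ r B k)

  -- "countable": contained in the range of some ℕ-sequence

  record wA2 : Set where
    field
      fin-refl  : ∀ a → a ≤fin a
      fin-trans : ∀ {a b c} → a ≤fin b → b ≤fin c → a ≤fin c
      w1 : ∀ b → Σ (ℕ → AR) (λ e → ∀ a → a ≤fin b → ∃[ n ] (e n ≡ a))
      w2⇒ : ∀ A B → A ≼ B → ∀ n → ∃[ m ] (r A n ≤fin r B m)
      w2⇐ : ∀ A B → (∀ n → ∃[ m ] (r A n ≤fin r B m)) → A ≼ B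
      w3 : ∀ a b c → a ⊑ b → b ≤fin c → ∃[ d ] (d ⊑ c × a ≤fin d)

  record A3 : Set where
    field
      A3-1 : ∀ B a n → Depth B a n → ∀ A → [ n , B ]ₙ A → ∃[ C ] [ a , A ] C
      A3-2 : ∀ A B a → A ≼ B → ∃[ C ] [ a , A ] C → ∀ n → Depth B a n →
               ∃[ A' ] ([ n , B ]ₙ A' × ∃[ C ] [ a , A' ] C ×
                        (∀ C → [ a , A' ] C → [ a , A ] C))

  A4 : Set₁
  A4 = ∀ B a n → Depth B a n → ∀ l → Lh a l →
         (O : AR → Set) → (∀ b → O b → Lh b (suc l)) →
         ∃[ A ] ([ n , B ]ₙ A ×
                 ((∀ b → r[ a , A ]ₙ (suc l) b → O b) ⊎
                  (∀ b → r[ a , A ]ₙ (suc l) b → ¬ O b)))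

  -- R (identified with {(r_n(A))_n}) is closed in AR^ℕ (AR discrete)
  Closed : Set
  Closed = ∀ (f : ℕ → AR) →
             (∀ n → ∃[ A ] (∀ k → k < n → r A k ≡ f k)) →
             ∃[ A ] (∀ n → r A n ≡ f n)

  record IsWA2Space : Set where
    field
      nonempty : R
      ≤-refl   : ∀ A → A ≼ A
      ≤-trans  : ∀ {A B C} → A ≼ B → B ≼ C → A ≼ C
      AR-image : ∀ a → ∃[ n ] Lh a n
      a1       : A1
      wa2      : wA2
      a3       : A3
      closed   : Closed

  Ramsey : (R → Set) → Set
  Ramsey X = ∀ A a → AR↾ A a →
    ∃[ B ] ([ a , A ] B × ((∀ C → [ a , B ] C → X C) ⊎ (∀ C → [ a , B ] C → ¬ X C)))

  -- Kastanas game K[a, A]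
  -- A play is given by sequences As (I's moves A_n), aₙ (a_n, with a_0 = a)
  -- and Bs (II's moves B_n); B_{-1} = A.


  Bprev : R → (ℕ → R) → ℕ → R
  Bprev A Bs zero    = A
  Bprev A Bs (suc n) = Bs n

  ILegal : R → (ℕ → R) → (ℕ → AR) → (ℕ → R) → ℕ → Set
  ILegal A As aₙ Bs n = [ aₙ n , Bprev A Bs n ] (As n)

  IILegal : (ℕ → R) → (ℕ → AR) → (ℕ → R) → ℕ → Set
  IILegal As aₙ Bs n = Next (aₙ n) (As n) (aₙ (suc n)) × [ aₙ (suc n) , As n ] (Bs n)

  Outcome : (ℕ → AR) → R → Set
  Outcome aₙ C = ∀ l → Lh (aₙ 0) l → ∀ n → r C (l + n) ≡ aₙ n

  -- strategies: I sees II's previous moves (a_{k+1}, B_k), k < n;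
  -- II sees I's moves A_0, …, A_n.
  StrategyI : Set
  StrategyI = (n : ℕ) → Vec (AR × R) n → R

  StrategyII : Set
  StrategyII = (n : ℕ) → Vec R (suc n) → AR × R

  playI : StrategyI → (ℕ → AR) → (ℕ → R) → ℕ → R
  playI σ aₙ Bs n = σ n (tabulate (λ (k : Fin n) → aₙ (suc (toℕ k)) , Bs (toℕ k)))

  IWins : AR → R → StrategyI → (R → Set) → Set
  IWins a A σ Y = ∀ (aₙ : ℕ → AR) (Bs : ℕ → R) → aₙ 0 ≡ a →
      (∀ n → (∀ k → k < n → IILegal (playI σ aₙ Bs) aₙ Bs k) →
             ILegal A (playI σ aₙ Bs) aₙ Bs n)
    × ((∀ n → IILegal (playI σ aₙ Bs) aₙ Bs n) → ∀ C → Outcome aₙ C → Y C)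

  moveII : StrategyII → (ℕ → R) → ℕ → AR × R
  moveII τ As n = τ n (tabulate (λ (k : Fin (suc n)) → As (toℕ k)))

  playIIa : AR → StrategyII → (ℕ → R) → ℕ → AR
  playIIa a τ As zero    = a
  playIIa a τ As (suc n) = proj₁ (moveII τ As n)

  playIIB : StrategyII → (ℕ → R) → ℕ → R
  playIIB τ As n = proj₂ (moveII τ As n)

  IIWins : AR → R → StrategyII → (R → Set) → Set
  IIWins a A τ Y = ∀ (As : ℕ → R) →
      (∀ n → (∀ k → k ≤ n → ILegal A As (playIIa a τ As) (playIIB τ As) k) →
             IILegal As (playIIa a τ As) (playIIB τ As) n)
    × ((∀ n → ILegal A As (playIIa a τ As) (playIIB τ As) n) →
       ∀ C → Outcome (playIIa a τ As) C → Y C)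

  KastanasRamsey : (R → Set) → Set
  KastanasRamsey X = ∀ A a → AR↾ A a →
    ∃[ B ] ([ a , A ] B ×
      ((∃[ σ ] IWins a B σ (λ C → ¬ X C)) ⊎ (∃[ τ ] IIWins a B τ X)))

{-# OPTIONS --safe #-}
-- X = {C : r_{l+1}(C) ∈ O}, for an instance (B, a, O) witnessing the failure of A4.
-- Membership in X is decided by a finite approximation, so the Kastanas game for X is a
-- finite game and, classically, determined by backward induction: whichever player wins
-- the initial position can always move to a position that is again winning for them.
-- If X were Ramsey, A3(2) would shrink a homogeneous B' ∈ [a, B] to some A ∈ [depth_B(a), B]
-- with [a, A] ⊆ [a, B']; every b ∈ r_{l+1}[a, A] is r_{l+1}(C) for some C ∈ [a, A] by A3(1),
-- so r_{l+1}[a, A] would be O-homogeneous, contradicting the choice of O.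
module Submission where

open import Defs
open import Level using (0ℓ)
open import Axiom.ExcludedMiddle using (ExcludedMiddle)
open import Axiom.DoubleNegationElimination using (em⇒dne)
open import Data.Product using (Σ-syntax; ∃-syntax; _×_; _,_; proj₁; proj₂; uncurry)
open import Data.Sum using (_⊎_; inj₁; inj₂) renaming (map to map⊎)
open import Data.Empty using (⊥-elim)
open import Data.Bool using (Bool; T)
open import Data.Nat using (ℕ; zero; suc; _+_; _∸_; _≤_; _<_)
open import Data.Nat.Properties
  using (≤-refl; <⇒≤; ≮⇒≥; n≤1+n; m≤n⇒m<n∨m≡n; m≤n+m∸n; n∸n≡0; +-∸-assoc; +-identityʳ; +-suc)
open import Data.Nat.Induction using (<-wellFounded)
open import Induction.WellFounded using (Acc; acc)
open import Data.Fin using (Fin; fromℕ; toℕ)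
open import Data.Fin.Properties using (toℕ-fromℕ)
open import Data.Vec using (lookup; tabulate)
open import Data.Vec.Properties using (lookup∘tabulate)
open import Function using (_∘_; const)
open import Relation.Nullary using (¬_; yes; no)
open import Relation.Nullary.Decidable using (isYes; toWitness; fromWitness)
open import Relation.Binary.PropositionalEquality using (_≡_; refl; sym; trans; cong; subst; subst₂)

least-witness : ExcludedMiddle 0ℓ → (P : ℕ → Set) →
                ∀ {k} → P k → ∃[ m ] (P m × (∀ j → P j → m ≤ j))
least-witness em P {k} = go (<-wellFounded k)
  where
  go : ∀ {k} → Acc _<_ k → P k → ∃[ m ] (P m × (∀ j → P j → m ≤ j))
  go {k} (acc smaller) pk with em {∃[ j ] (j < k × P j)}
  ... | yes (j , j<k , pj) = go (smaller j<k) pj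
  ... | no none = k , pk , λ j pj → ≮⇒≥ (λ j<k → none (j , j<k , pj))

lookup-last-tabulate : ∀ {A : Set} n (f : ℕ → A) →
                       lookup (tabulate (λ (k : Fin (suc n)) → f (toℕ k))) (fromℕ n) ≡ f n
lookup-last-tabulate n f = trans (lookup∘tabulate (f ∘ toℕ) (fromℕ n)) (cong f (toℕ-fromℕ n))

module InitialSegments (S : Structure) (a1 : Notions.A1 S) where
  open Structure S
  open Notions S
  open A1 a1

  lh-unique : ∀ {c i j} → Lh c i → Lh c j → i ≡ j
  lh-unique (A , rA) (B , rB) = proj₁ (A1-3 A B _ _ (trans rA (sym rB)))

  r-at-lh : ∀ {c i} C → Lh c i → ∃[ k ] (r C k ≡ c) → r C i ≡ c
  r-at-lh C lhc (k , rC) with lh-unique (C , rC) lhc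
  ... | refl = rC

  agree-below : ∀ C D {i j} → i ≤ j → r C j ≡ r D j → r C i ≡ r D i
  agree-below C D i≤j eq with m≤n⇒m<n∨m≡n i≤j
  ... | inj₁ i<j  = proj₂ (A1-3 C D _ _ eq) _ i<j
  ... | inj₂ refl = eq

  next-lh : ∀ {c i A b} → Lh c i → Next c A b → Lh b (suc i)
  next-lh lhc (_ , lhc′ , _ , _ , lhb) with lh-unique lhc lhc′
  ... | refl = lhb

module WA2Space (em : ExcludedMiddle 0ℓ) (S : Structure) (W2 : Notions.IsWA2Space S) where
  open Structure S
  open Notions S
  open IsWA2Space W2 renaming (≤-refl to ≼-refl)
  open wA2 wa2 using (fin-refl)
  open A3 a3
  open InitialSegments S a1

  dne : ∀ {P : Set} → ¬ ¬ P → P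
  dne = em⇒dne em

  depth-exists : ∀ {A a} → AR↾ A a → ∃[ d ] Depth A a d
  depth-exists {A} {a} (m , a≤Aₘ) = least-witness em (λ k → a ≤fin r A k) a≤Aₘ

  [a,A]-inhabited : ∀ {A a} → AR↾ A a → ∃[ B ] [ a , A ] B
  [a,A]-inhabited {A} {a} a∈AR↾A with depth-exists a∈AR↾A
  ... | d , depth = A3-1 A a d depth A (≼-refl A , d , refl)

  Reply : AR → R → AR × R → Set
  Reply c A (b , B) = Next c A b × [ b , A ] B

  canonical-reply : ∀ A i → Reply (r A i) A (r A (suc i) , A)
  canonical-reply A i =
    (i , (A , refl) , (suc i , fin-refl _) , (A , i , suc i , n≤1+n i , refl , refl) , (A , refl)) ,
    (≼-refl A , suc i , refl)

  -- Starting from a of length l, after N = L ∸ l rounds r_L of the outcome is known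
  -- (when L < l it is already known from a, and the game is trivial).
  module ClopenGame (Q : AR → Set) (L l : ℕ) where
    N : ℕ
    N = L ∸ l

    Decides : AR → Set
    Decides c = ∀ C → r C (l + N) ≡ c → Q (r C L)

    IIWinsIn : ℕ → AR × R → Set
    WinningReply : ℕ → AR → R → Set

    IIWinsIn zero    (c , _) = Decides c
    IIWinsIn (suc k) (c , D) = ∀ A → [ c , D ] A → WinningReply k c A

    WinningReply k c A = ∃[ p ] (Reply c A p × IIWinsIn k p)

    rounds-left : ∀ {n} → n < N → N ∸ n ≡ suc (N ∸ suc n)
    rounds-left = +-∸-assoc 1

    replyII : ∀ n A → Σ[ p ∈ AR × R ] (Reply (r A (l + n)) A p ×
                (WinningReply (N ∸ suc n) (r A (l + n)) A → IIWinsIn (N ∸ suc n) p))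
    replyII n A with em {WinningReply (N ∸ suc n) (r A (l + n)) A}
    ... | yes (p , reply , wins) = p , reply , const wins
    ... | no noWin = _ , canonical-reply A (l + n) , ⊥-elim ∘ noWin

    -- II only sees I's moves; the current a_n is recovered as r_{l+n}(A_n).
    τ : StrategyII
    τ n As = proj₁ (replyII n (lookup As (fromℕ n)))

    τ-move : ∀ As n → moveII τ As n ≡ proj₁ (replyII n (As n))
    τ-move As n = cong (proj₁ ∘ replyII n) (lookup-last-tabulate n As)

    τ-lh : ∀ {a} → Lh a l → ∀ As n → Lh (playIIa a τ As n) (l + n)
    τ-lh {a} lha As zero    = subst (Lh a) (sym (+-identityʳ l)) lha
    τ-lh lha As (suc n) =
      subst₂ Lh (sym (cong proj₁ (τ-move As n))) (sym (+-suc l n))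
        (next-lh (As n , refl) (proj₁ (proj₁ (proj₂ (replyII n (As n))))))

    τ-wins : ∀ {a B} → Lh a l → IIWinsIn N (a , B) → IIWins a B τ (λ C → Q (r C L))
    τ-wins {a} {B} lha won As = legal , wins
      where
      aₙ : ℕ → AR
      aₙ = playIIa a τ As

      Bₙ : ℕ → R
      Bₙ = playIIB τ As

      position : ℕ → AR × R
      position n = aₙ n , Bprev B Bₙ n

      current : ∀ n → ILegal B As aₙ Bₙ n → r (As n) (l + n) ≡ aₙ n
      current n (_ , aₙ⊏Aₙ) = r-at-lh (As n) (τ-lh lha As n) aₙ⊏Aₙ

      legal : ∀ n → (∀ k → k ≤ n → ILegal B As aₙ Bₙ k) → IILegal As aₙ Bₙ n
      legal n hyp =
        subst (Reply (aₙ n) (As n)) (sym (τ-move As n))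
          (subst (λ c → Reply c (As n) _) (current n (hyp n ≤-refl))
            (proj₁ (proj₂ (replyII n (As n)))))

      invariant : (∀ n → ILegal B As aₙ Bₙ n) → ∀ n → n ≤ N → IIWinsIn (N ∸ n) (position n)
      invariant hyp zero    _   = won
      invariant hyp (suc n) n<N =
        subst (IIWinsIn (N ∸ suc n)) (sym (τ-move As n)) (proj₂ (proj₂ (replyII n (As n))) winning)
        where
        winning : WinningReply (N ∸ suc n) (r (As n) (l + n)) (As n)
        winning = subst (λ c → WinningReply (N ∸ suc n) c (As n)) (sym (current n (hyp n)))
                    (subst (λ k → IIWinsIn k (position n)) (rounds-left n<N) (invariant hyp n (<⇒≤ n<N))
                      (As n) (hyp n))

      wins : (∀ n → ILegal B As aₙ Bₙ n) → ∀ C → Outcome aₙ C → Q (r C L)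
      wins hyp C outcome =
        subst (λ k → IIWinsIn k (position N)) (n∸n≡0 N) (invariant hyp N ≤-refl) C (outcome l lha N)

    challengeI : ∀ n c D → Σ[ A ∈ R ] ((∃[ j ] (r D j ≡ c) → [ c , D ] A) ×
              (¬ IIWinsIn (suc (N ∸ suc n)) (c , D) → ¬ WinningReply (N ∸ suc n) c A))
    challengeI n c D with em {∃[ A ] ([ c , D ] A × ¬ WinningReply (N ∸ suc n) c A)}
    ... | yes (A , legal , noReply) = A , const legal , const noReply
    ... | no noSpoiler =
      D , (λ c⊏D → ≼-refl D , c⊏D) ,
      λ lost → ⊥-elim (lost λ A legal → dne λ noReply → noSpoiler (A , legal , noReply))

    σ : AR → R → StrategyI
    σ a B zero    _ = proj₁ (challengeI 0 a B)
    σ a B (suc n) v = proj₁ (uncurry (challengeI (suc n)) (lookup v (fromℕ n)))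

    σ-move : ∀ {B} aₙ Bs n → playI (σ (aₙ 0) B) aₙ Bs n ≡ proj₁ (challengeI n (aₙ n) (Bprev B Bs n))
    σ-move aₙ Bs zero    = refl
    σ-move aₙ Bs (suc n) =
      cong (proj₁ ∘ uncurry (challengeI (suc n))) (lookup-last-tabulate n (λ k → aₙ (suc k) , Bs k))

    σ-wins : ∀ {a B} → Lh a l → ∃[ j ] (r B j ≡ a) → ¬ IIWinsIn N (a , B) →
             IWins a B (σ a B) (λ C → ¬ Q (r C L))
    σ-wins {B = B} lha a⊏B lost aₙ Bs refl = legal , wins
      where
      Aₙ : ℕ → R
      Aₙ = playI (σ (aₙ 0) B) aₙ Bs

      position : ℕ → AR × R
      position n = aₙ n , Bprev B Bs n

      segment : ∀ n → (∀ k → k < n → IILegal Aₙ aₙ Bs k) → ∃[ j ] (r (Bprev B Bs n) j ≡ aₙ n)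
      segment zero    _   = a⊏B
      segment (suc n) hyp = proj₂ (proj₂ (hyp n ≤-refl))

      legal : ∀ n → (∀ k → k < n → IILegal Aₙ aₙ Bs k) → ILegal B Aₙ aₙ Bs n
      legal n hyp = subst [ aₙ n , Bprev B Bs n ] (sym (σ-move aₙ Bs n))
                      (proj₁ (proj₂ (challengeI n (aₙ n) (Bprev B Bs n))) (segment n hyp))

      wins : (∀ n → IILegal Aₙ aₙ Bs n) → ∀ C → Outcome aₙ C → ¬ Q (r C L)
      wins hyp C outcome q = subst (λ k → ¬ IIWinsIn k (position N)) (n∸n≡0 N) (invariant N ≤-refl) decided
        where
        invariant : ∀ n → n ≤ N → ¬ IIWinsIn (N ∸ n) (position n)
        invariant zero    _   = lost
        invariant (suc n) n<N won =
          proj₂ (proj₂ (challengeI n (aₙ n) (Bprev B Bs n)))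
            (subst (λ k → ¬ IIWinsIn k (position n)) (rounds-left n<N) (invariant n (<⇒≤ n<N)))
            (_ , subst (λ A → Reply (aₙ n) A _) (σ-move aₙ Bs n) (hyp n) , won)

        decided : Decides (aₙ N)
        decided C′ C′≡aₙ =
          subst Q (agree-below C C′ (m≤n+m∸n L l) (trans (outcome l lha N) (sym C′≡aₙ))) q

    determined : ∀ {a B} → Lh a l → ∃[ j ] (r B j ≡ a) →
                 (∃[ σ ] IWins a B σ (λ C → ¬ Q (r C L))) ⊎ (∃[ τ ] IIWins a B τ (λ C → Q (r C L)))
    determined {a} {B} lha a⊏B with em {IIWinsIn N (a , B)}
    ... | yes won = inj₂ (τ , τ-wins lha won)
    ... | no lost = inj₁ (σ a B , σ-wins lha a⊏B lost)

  clopen-KastanasRamsey : (Q : AR → Set) (L : ℕ) → KastanasRamsey (λ C → Q (r C L))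
  clopen-KastanasRamsey Q L A a a∈AR↾A with [a,A]-inhabited a∈AR↾A | AR-image a
  ... | B , B∈[a,A] | l , lha = B , B∈[a,A] , ClopenGame.determined Q L l lha (proj₂ B∈[a,A])

  realise : ∀ {a l A b} → Lh a l → r[ a , A ]ₙ (suc l) b → ∃[ C ] ([ a , A ] C × r C (suc l) ≡ b)
  realise {a} {l} {b = b} lha (b∈AR↾A , (D , m , j , _ , Dₘ≡a , Dⱼ≡b) , lhb) with [a,A]-inhabited b∈AR↾A
  ... | C , C≼A , b⊏C = C , (C≼A , l , Cₗ≡a) , Cₗ₊₁≡b
    where
    Cₗ₊₁≡b : r C (suc l) ≡ b
    Cₗ₊₁≡b = r-at-lh C lhb b⊏C

    Cₗ≡a : r C l ≡ a
    Cₗ≡a = trans (agree-below C D (n≤1+n l) (trans Cₗ₊₁≡b (sym (r-at-lh D lhb (j , Dⱼ≡b)))))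
                 (r-at-lh D lha (m , Dₘ≡a))

  -- Excluded middle is only available in Set, while A4 quantifies over O : AR → Set,
  -- so a failure of A4 is extracted with a Boolean-valued O.
  record A4Instance : Set where
    field
      B     : R
      a     : AR
      n     : ℕ
      depth : Depth B a n
      l     : ℕ
      lha   : Lh a l
      O     : AR → Bool
      O-lh  : ∀ b → T (O b) → Lh b (suc l)

    Homogeneous : R → Set
    Homogeneous A = (∀ b → r[ a , A ]ₙ (suc l) b → T (O b))
                  ⊎ (∀ b → r[ a , A ]ₙ (suc l) b → ¬ T (O b))

    Satisfied : Set
    Satisfied = ∃[ A ] ([ n , B ]ₙ A × Homogeneous A)

    X : R → Set
    X C = T (O (r C (suc l)))

    not-Ramsey : ¬ Satisfied → ¬ Ramsey X
    not-Ramsey unsatisfied ramsey with ramsey B a (n , proj₁ depth)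
    ... | B′ , (B′≼B , a⊏B′) , homogeneous with A3-2 B′ B a B′≼B (B′ , ≼-refl B′ , a⊏B′) n depth
    ... | A , A∈[n,B] , _ , _ , [a,A]⊆[a,B′] = unsatisfied (A , A∈[n,B] , map⊎ inside outside homogeneous)
      where
      inside : (∀ C → [ a , B′ ] C → X C) → ∀ b → r[ a , A ]ₙ (suc l) b → T (O b)
      inside inX b b∈ with realise lha b∈
      ... | C , C∈[a,A] , refl = inX C ([a,A]⊆[a,B′] C C∈[a,A])

      outside : (∀ C → [ a , B′ ] C → ¬ X C) → ∀ b → r[ a , A ]ₙ (suc l) b → ¬ T (O b)
      outside notX b b∈ with realise lha b∈
      ... | C , C∈[a,A] , refl = notX C ([a,A]⊆[a,B′] C C∈[a,A])

  A4-from-Boolean : (∀ t → A4Instance.Satisfied t) → A4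
  A4-from-Boolean satisfied B a n depth l lha O O-lh
    with satisfied (record { B = B ; a = a ; n = n ; depth = depth ; l = l ; lha = lha
                           ; O = λ b → isYes (em {O b}) ; O-lh = λ b → O-lh b ∘ toWitness })
  ... | A , A∈[n,B] , homogeneous =
    A , A∈[n,B] , map⊎ (λ inO b b∈ → toWitness (inO b b∈))
                       (λ outO b b∈ → outO b b∈ ∘ fromWitness) homogeneous

  unsatisfied-A4-instance : ¬ A4 → ∃[ t ] ¬ A4Instance.Satisfied t
  unsatisfied-A4-instance ¬A4 =
    dne λ none → ¬A4 (A4-from-Boolean λ t → dne λ unsatisfied → none (t , unsatisfied))

proposition3p10 : ExcludedMiddle 0ℓ → (S : Structure) →
    Notions.IsWA2Space S → ¬ Notions.A4 S →
    ∃[ X ] (Notions.KastanasRamsey S X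
           × Notions.KastanasRamsey S (λ C → ¬ X C)
           × ¬ Notions.Ramsey S X)
proposition3p10 em S W ¬A4 with WA2Space.unsatisfied-A4-instance em S W ¬A4
... | t , unsatisfied =
  X , clopen-KastanasRamsey (T ∘ O) (suc l) , clopen-KastanasRamsey (¬_ ∘ T ∘ O) (suc l) ,
  not-Ramsey unsatisfied
  where
  open WA2Space em S W
  open A4Instance t
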